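{- There is an absolute constant $c>0$ such that for all integers $2\le m\le n$ and every $m\times n$ matrix $A$ with entries $1,\dots,mn$ (each exactly once), the number of rotations of the first row $R$ performed by procedure FillColumns on input $A$ is at most $c\cdot mn\log n$.
   Context: Rows and columns are numbered from $1$. For $x\in\{1,\dots,mn\}$ let $\mathrm{col}(x)=((x-1)\bmod n)+1$ (its target column). $R$ denotes the first row and $C_j$ the $j$-th column; $R[j]$ and $C_j[i]$ denote the element at column $j$ of $R$, respectively at row $i$ of $C_j$; so $R[j]=C_j[1]$. "Rotate $R$" means a unit rightward rotation of the first row ($R[j]\to R[j+1]$ for $j<n$, $R[n]\to R[1]$). "Rotate $C_j$" means a unit downward rotation of column $j$ ($C_j[i]\to C_j[i+1]$ for $i<m$, $C_j[m]\to C_j[1]$). The body of $C_j$ consists of positions $C_j[2],\dots,C_j[m]$. A column $C_j$ is near-full if every element $x$ in its body has $\mathrm{col}(x)=j$, and underfull otherwise. Procedure FillColumns: while there exists an underfull column, do the following: for $j=1,\dots,n$ in order, while $\mathrm{col}(R[j])=j$ and $C_j$ is underfull, rotate $C_j$; after the for-loop, rotate $R$ once. -}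

module Defs where

open import Data.Nat using (ℕ; zero; suc; _∸_; _<_; _≤_; _*_)
open import Data.Nat.Properties using (_≟_; _<?_)
open import Data.Nat.DivMod using (_%_)
open import Data.Fin using (Fin; zero; suc; toℕ; fromℕ; inject₁)
import Data.Fin.Properties as FinP
open import Data.List using (foldl; allFin)
open import Data.Product using (_×_; ∃-syntax)
open import Relation.Nullary using (Dec; yes; no; _→-dec_)
open import Relation.Binary.PropositionalEquality using (_≡_)

-- An m × n matrix of naturals. Rows/columns are 0-indexed internally:
-- internal row i / column j is the paper's row (toℕ i + 1) / column (toℕ j + 1).
Mat : ℕ → ℕ → Set
Mat m n = Fin m → Fin n → ℕ

IsPermMatrix : ∀ {m n} → Mat m n → Set
IsPermMatrix {m} {n} A =
  (∀ i j → 1 ≤ A i j × A i j ≤ m * n)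
  × (∀ i j i′ j′ → A i j ≡ A i′ j′ → (i ≡ i′ × j ≡ j′))
  × (∀ x → 1 ≤ x → x ≤ m * n → ∃[ i ] ∃[ j ] A i j ≡ x)

-- target column (1-indexed, as in the paper): col(x) = ((x-1) mod n) + 1
col : (n : ℕ) → .{{_ : Data.Nat.NonZero n}} → ℕ → ℕ
col n x = suc ((x ∸ 1) % n)

cpred : ∀ {k} → Fin k → Fin k
cpred {suc k} zero    = fromℕ k
cpred {suc k} (suc i) = inject₁ i

rotR : ∀ {m n} → Mat m n → Mat m n
rotR A zero    j = A zero (cpred j)
rotR A (suc i) j = A (suc i) j

rotC : ∀ {m n} → Fin n → Mat m n → Mat m n
rotC j A i k with k FinP.≟ j
... | yes _ = A (cpred i) k
... | no  _ = A i k

NearFull : ∀ {m n} → .{{_ : Data.Nat.NonZero n}} → Mat m n → Fin n → Set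
NearFull {m} {n} A j = ∀ (i : Fin m) → 0 < toℕ i → col n (A i j) ≡ suc (toℕ j)

nearFull? : ∀ {m n} → .{{_ : Data.Nat.NonZero n}} → (A : Mat m n) → (j : Fin n) → Dec (NearFull A j)
nearFull? {m} {n} A j = FinP.all? (λ i → (0 <? toℕ i) →-dec (col n (A i j) ≟ suc (toℕ j)))

-- Inner loop for column j: while col(R[j]) = j and C_j is underfull, rotate C_j.
-- Run with fuel; with fuel m it is exact, since the loop always stops after
-- fewer than m rotations.
innerLoop : ∀ {m n} → .{{_ : Data.Nat.NonZero n}} → ℕ → Fin n → Mat m n → Mat m n
innerLoop {zero}  _        j A = A
innerLoop {suc m} zero     j A = A
innerLoop {suc m} {n} (suc f) j A with col n (A zero j) ≟ suc (toℕ j) | nearFull? A j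
... | yes _ | no _ = innerLoop f j (rotC j A)
... | _     | _    = A

outerBody : ∀ {m n} → .{{_ : Data.Nat.NonZero n}} → Mat m n → Mat m n
outerBody {m} {n} A = rotR (foldl (λ B j → innerLoop m j B) A (allFin n))

iterBody : ∀ {m n} → .{{_ : Data.Nat.NonZero n}} → ℕ → Mat m n → Mat m n
iterBody zero    A = A
iterBody (suc k) A = iterBody k (outerBody A)

AllNearFull : ∀ {m n} → .{{_ : Data.Nat.NonZero n}} → Mat m n → Set
AllNearFull {n = n} A = ∀ (j : Fin n) → NearFull A j

-- FillColumns performs at most k rotations of R: the while-loop (which
-- rotates R exactly once per iteration and stops as soon as no column is
-- underfull) has stopped after at most k iterations.
RotationsAtMost : ∀ {m n} → .{{_ : Data.Nat.NonZero n}} → Mat m n → ℕ → Set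
RotationsAtMost A k = ∃[ t ] (t ≤ k × AllNearFull (iterBody t A))

-- Call an entry x good for column j when col x = j + 1, and measure the progress of FillColumns
-- after each for-loop by the deficiency D = Σⱼ (m − 1 − number of good entries in the body of Cⱼ).
-- The body of a column never loses good entries, and a column that is still underfull after its
-- inner loop has a bad top entry, so a good entry arriving at R[j] is pushed into the body.
-- An entry of R that belongs in column j moves one step right per rotation of R until it reaches
-- R[j], since a column only rotates while its top entry belongs to it; so a column that stays
-- underfull for n − 1 rounds absorbs all of them. Exactly m values belong in a column, so a full
-- column has at most one of them in R; counting the n entries of R gives 2D′ + U ≤ 2D and D ≤ mU,
-- where U is the number of underfull columns and D′ the deficiency n − 1 rounds later. Hence D
-- halves every 2m(n − 1) rounds, and as D < n² < 4^(⌊log₂ n⌋ + 1) it vanishes after O(mn log n)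
-- rounds.

module Submission where

open import Data.Nat using (ℕ; zero; suc; _+_; _*_; _∸_; _≤_; _<_; _^_; z≤n; s≤s; z<s; NonZero)
open import Data.Nat.Properties
open import Data.Nat.DivMod using (_%_; _/_; m%n<n; m≡m%n+[m/n]*n; m<n*o⇒m/o<n)
open import Data.Fin using (Fin; zero; suc; toℕ; fromℕ<; lower₁; punchIn)
import Data.Fin.Properties as Finₚ
open import Data.Vec.Functional using (Vector; removeAt)
open import Data.Product using (Σ-syntax; _×_; _,_; proj₁; proj₂; uncurry; ∃-syntax)
open import Data.Sum using (_⊎_; inj₁; inj₂; fromInj₂; swap)
open import Data.List.Relation.Unary.All as All using (All; []; _∷_)
open import Data.List.Relation.Unary.Any using (here; there)
open import Data.List.Relation.Unary.AllPairs using ([]; _∷_)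
open import Data.List.Relation.Unary.Unique.Propositional using (Unique)
open import Data.List.Relation.Unary.Unique.Propositional.Properties using (allFin⁺)
open import Data.List.Membership.Propositional using (_∈_)
open import Data.List.Membership.Propositional.Properties using (∈-allFin)
open import Data.Product.Properties using (,-injectiveˡ; ,-injectiveʳ)
open import Data.List using (List; []; _∷_; foldl; allFin)
open import Data.Nat.Tactic.RingSolver using (solve-∀)
open import Data.Nat.Logarithm using (⌊log₂_⌋; ⌊log₂⌋-mono-≤; ⌊log₂[2^n]⌋≡n)
open import Function using (_∘_)
open import Level using (Level)
open import Data.Empty using (⊥-elim)
open import Relation.Nullary using (Dec; yes; no; ¬_; _→-dec_; _×-dec_)
open import Relation.Unary using (Pred; Decidable)
open import Relation.Binary.PropositionalEquality
open import Algebra.Properties.Semiring.Sum +-*-semiring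
  using (sum; sum-syntax; sum-cong-≗; sum-init-last; sum-remove; ∑-distrib-+; ∑-comm; *-distribˡ-sum)
open import Algebra.Properties.CommutativeSemigroup +-commutativeSemigroup using (x∙yz≈yx∙z)
open import Defs

private variable
  a p q : Level
  A B : Set a
  k m n : ℕ

⟦_⟧ : Dec A → ℕ
⟦ yes _ ⟧ = 1
⟦ no _ ⟧ = 0

⟦⟧≤1 : (d : Dec A) → ⟦ d ⟧ ≤ 1
⟦⟧≤1 (yes _) = ≤-refl
⟦⟧≤1 (no _) = z≤n

⟦⟧-mono : (d : Dec A) (e : Dec B) → (A → B) → ⟦ d ⟧ ≤ ⟦ e ⟧
⟦⟧-mono (yes x) (yes _) f = ≤-refl
⟦⟧-mono (yes x) (no ¬y) f = ⊥-elim (¬y (f x))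
⟦⟧-mono (no _) e f = z≤n

⟦⟧-cong : (d : Dec A) (e : Dec B) → (A → B) → (B → A) → ⟦ d ⟧ ≡ ⟦ e ⟧
⟦⟧-cong d e f g = ≤-antisym (⟦⟧-mono d e f) (⟦⟧-mono e d g)

⟦yes⟧ : (d : Dec A) → A → ⟦ d ⟧ ≡ 1
⟦yes⟧ (yes _) _ = refl
⟦yes⟧ (no ¬x) x = ⊥-elim (¬x x)

⟦no⟧ : (d : Dec A) → ¬ A → ⟦ d ⟧ ≡ 0
⟦no⟧ (yes x) ¬x = ⊥-elim (¬x x)
⟦no⟧ (no _) _ = refl

sum-mono-≤ : {f g : Vector ℕ k} → (∀ i → f i ≤ g i) → sum f ≤ sum g
sum-mono-≤ {zero} _ = z≤n
sum-mono-≤ {suc k} f≤g = +-mono-≤ (f≤g zero) (sum-mono-≤ (f≤g ∘ suc))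

sum-const : ∀ k c → ∑[ i < k ] c ≡ k * c
sum-const zero c = refl
sum-const (suc k) c = cong (c +_) (sum-const k c)

sum-≤-length : {f : Vector ℕ k} → (∀ i → f i ≤ 1) → sum f ≤ k
sum-≤-length {k} f≤1 = ≤-trans (sum-mono-≤ f≤1) (≤-reflexive (trans (sum-const k 1) (*-identityʳ k)))

term≤sum : (f : Vector ℕ k) (i : Fin k) → f i ≤ sum f
term≤sum f zero = m≤m+n (f zero) _
term≤sum f (suc i) = ≤-trans (term≤sum (f ∘ suc) i) (m≤n+m _ (f zero))

sum≡0⇒term≡0 : (f : Vector ℕ k) → sum f ≡ 0 → ∀ i → f i ≡ 0
sum≡0⇒term≡0 f s≡0 i = n≤0⇒n≡0 (≤-trans (term≤sum f i) (≤-reflexive s≡0))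

sum-<-length : (f : Vector ℕ k) → (∀ i → f i ≤ 1) → ∀ i → f i ≡ 0 → sum f < k
sum-<-length f f≤1 zero    f0≡0 =
  s≤s (≤-trans (≤-reflexive (cong (_+ sum (f ∘ suc)) f0≡0)) (sum-≤-length (f≤1 ∘ suc)))
sum-<-length f f≤1 (suc i) fi≡0 = +-mono-≤-< (f≤1 zero) (sum-<-length (f ∘ suc) (f≤1 ∘ suc) i fi≡0)

sum-cpred : (f : Vector ℕ (suc k)) → sum (f ∘ cpred) ≡ sum f
sum-cpred f = trans (+-comm (f (cpred zero)) _) (sym (sum-init-last f))

sum-split-at : (f g : Vector ℕ (suc k)) (j : Fin (suc k)) {c : ℕ} →
               f j ≤ c → (∀ i → i ≢ j → f i ≤ g i) → sum f ≤ c + sum g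
sum-split-at f g j {c} fj≤c f≤g = begin
  sum f                         ≡⟨ sum-remove {i = j} f ⟩
  f j + sum (removeAt f j)      ≤⟨ +-mono-≤ fj≤c (sum-mono-≤ (λ i → f≤g (punchIn j i) (Finₚ.punchInᵢ≢i j i))) ⟩
  c + sum (removeAt g j)        ≤⟨ +-monoʳ-≤ c (m≤n+m (sum (removeAt g j)) (g j)) ⟩
  c + (g j + sum (removeAt g j)) ≡⟨ cong (c +_) (sum-remove {i = j} g) ⟨
  c + sum g                     ∎
  where open ≤-Reasoning

count-none : {P : Pred (Fin k) p} (P? : Decidable P) → (∀ i → ¬ P i) → ∑[ i < k ] ⟦ P? i ⟧ ≡ 0
count-none {zero} P? ¬P = refl
count-none {suc k} P? ¬P =
  trans (cong (_+ ∑[ i < k ] ⟦ P? (suc i) ⟧) (⟦no⟧ (P? zero) (¬P zero))) (count-none (P? ∘ suc) (¬P ∘ suc))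

count-unique : {P : Pred (Fin k) p} (P? : Decidable P) →
               (∀ {i j} → P i → P j → i ≡ j) → ∑[ i < k ] ⟦ P? i ⟧ ≤ 1
count-unique {zero} P? uniq = z≤n
count-unique {suc k} P? uniq with P? zero
... | yes P0 = ≤-reflexive (cong suc (count-none (P? ∘ suc) (λ i Pi → Finₚ.0≢1+n (uniq P0 Pi))))
... | no _ = count-unique (P? ∘ suc) (λ Pi Pj → Finₚ.suc-injective (uniq Pi Pj))

count-unique₂ : {P : Pred (Fin k) p} {l : ℕ} {Q : Pred (Fin l) q} (P? : Decidable P) (Q? : Decidable Q) →
                (∀ {i j} → P i → P j → i ≡ j) → (∀ {i j} → Q i → Q j → i ≡ j) →
                (∀ {i j} → P i → ¬ Q j) →
                ∑[ i < k ] ⟦ P? i ⟧ + ∑[ j < l ] ⟦ Q? j ⟧ ≤ 1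
count-unique₂ {k = k} {l = l} P? Q? uniqP uniqQ P⇒¬Q with Finₚ.any? P?
... | yes (i , Pi) = ≤-trans (≤-reflexive (trans (cong (∑[ i < k ] ⟦ P? i ⟧ +_) (count-none Q? (λ j → P⇒¬Q Pi)))
                                                (+-identityʳ _)))
                             (count-unique P? uniqP)
... | no ∄P = ≤-trans (≤-reflexive (cong (_+ ∑[ j < l ] ⟦ Q? j ⟧) (count-none P? (λ i Pi → ∄P (i , Pi)))))
                      (count-unique Q? uniqQ)

count-≟toℕ : ∀ {x} → x < k → ∑[ y < k ] ⟦ x ≟ toℕ y ⟧ ≡ 1
count-≟toℕ {k} {x} x<k = ≤-antisym
  (count-unique {k = k} {P = λ y → x ≡ toℕ y} (λ y → x ≟ toℕ y)
                (λ x≡i x≡j → Finₚ.toℕ-injective (trans (sym x≡i) x≡j)))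
  (≤-trans (≤-reflexive (sym (⟦yes⟧ (x ≟ toℕ y) (sym (Finₚ.toℕ-fromℕ< x<k)))))
           (term≤sum (λ y → ⟦ x ≟ toℕ y ⟧) y))
  where
  y : Fin k
  y = fromℕ< x<k

cpred-preimage : (i : Fin (suc k)) → ∃[ i′ ] (cpred i′ ≡ i × (i′ ≡ zero ⊎ toℕ i′ ≡ suc (toℕ i)))
cpred-preimage {k} i with toℕ i ≟ k
... | yes i≡k = zero , Finₚ.toℕ-injective (trans (Finₚ.toℕ-fromℕ k) (sym i≡k)) , inj₁ refl
... | no  i≢k = suc (lower₁ i (i≢k ∘ sym)) , Finₚ.inject₁-lower₁ i (i≢k ∘ sym) ,
                inj₂ (cong suc (Finₚ.toℕ-lower₁ i (i≢k ∘ sym)))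

cpred-injective : {i j : Fin k} → cpred i ≡ cpred j → i ≡ j
cpred-injective {suc k} {zero} {zero} _ = refl
cpred-injective {suc k} {zero} {suc j} e = ⊥-elim (Finₚ.fromℕ≢inject₁ e)
cpred-injective {suc k} {suc i} {zero} e = ⊥-elim (Finₚ.fromℕ≢inject₁ (sym e))
cpred-injective {suc k} {suc i} {suc j} e = cong suc (Finₚ.inject₁-injective e)

module _ (n : ℕ) where

  cyclicGap : ℕ → ℕ → ℕ
  cyclicGap a b with a <? b
  ... | yes _ = b ∸ a
  ... | no _  = suc n + b ∸ a

  cyclicGap-positive : ∀ {a} b → a ≤ n → 0 < cyclicGap a b
  cyclicGap-positive {a} b a≤n with a <? b
  ... | yes a<b = m<n⇒0<n∸m a<b
  ... | no _    = m<n⇒0<n∸m (s≤s (≤-trans a≤n (m≤m+n n b)))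

  cyclicGap-≤ : ∀ {a b} → b ≤ n → a ≢ b → cyclicGap a b ≤ n
  cyclicGap-≤ {a} {b} b≤n a≢b with a <? b
  ... | yes _   = ≤-trans (m∸n≤m b a) b≤n
  ... | no a≮b  = m≤n+o⇒m∸n≤o (suc n + b) a (begin
    suc n + b ≡⟨ +-comm (suc n) b ⟩
    b + suc n ≡⟨ +-suc b n ⟩
    suc b + n ≤⟨ +-monoˡ-≤ n (≤∧≢⇒< (≮⇒≥ a≮b) (a≢b ∘ sym)) ⟩
    a + n     ∎)
    where open ≤-Reasoning

  cyclicGap-pred : ∀ {a b} → suc a ≤ n → suc a ≢ b → cyclicGap a b ≡ suc (cyclicGap (suc a) b)
  cyclicGap-pred {a} {b} 1+a≤n 1+a≢b with a <? b | suc a <? b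
  ... | yes _   | yes 1+a<b = +-∸-assoc 1 (<⇒≤ 1+a<b)
  ... | yes a<b | no 1+a≮b  = ⊥-elim (1+a≢b (≤-antisym a<b (≮⇒≥ 1+a≮b)))
  ... | no a≮b  | yes 1+a<b = ⊥-elim (a≮b (<-trans (n<1+n a) 1+a<b))
  ... | no _    | no _      = +-∸-assoc 1 (≤-trans 1+a≤n (≤-trans (n≤1+n n) (m≤m+n (suc n) b)))

  cyclicGap-wrap : ∀ {b} → b ≤ n → 0 ≢ b → cyclicGap n b ≡ suc (cyclicGap 0 b)
  cyclicGap-wrap {b} b≤n 0≢b with n <? b | 0 <? b
  ... | yes n<b | _       = ⊥-elim (<⇒≱ n<b b≤n)
  ... | no _    | yes _   = trans (cong (_∸ n) (sym (+-suc n b))) (m+n∸m≡n n (suc b))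
  ... | no _    | no 0≮b  = ⊥-elim (0≢b (sym (n≤0⇒n≡0 (≮⇒≥ 0≮b))))

-- The number of rotations of R taking position p to position j (a full turn when p = j).
cyclicDistance : Fin (suc k) → Fin (suc k) → ℕ
cyclicDistance {k} p j = cyclicGap k (toℕ p) (toℕ j)

cyclicDistance-positive : (p j : Fin (suc k)) → 0 < cyclicDistance p j
cyclicDistance-positive {k} p j = cyclicGap-positive k (toℕ j) (Finₚ.toℕ≤pred[n] p)

cyclicDistance-≤ : (p j : Fin (suc k)) → p ≢ j → cyclicDistance p j ≤ k
cyclicDistance-≤ {k} p j p≢j = cyclicGap-≤ k (Finₚ.toℕ≤pred[n] j) (p≢j ∘ Finₚ.toℕ-injective)

cyclicDistance-cpred : (p j : Fin (suc k)) → p ≢ j → cyclicDistance (cpred p) j ≡ suc (cyclicDistance p j)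
cyclicDistance-cpred {k} zero j 0≢j rewrite Finₚ.toℕ-fromℕ k =
  cyclicGap-wrap k (Finₚ.toℕ≤pred[n] j) (0≢j ∘ Finₚ.toℕ-injective)
cyclicDistance-cpred {k} (suc q) j p≢j rewrite Finₚ.toℕ-inject₁ q =
  cyclicGap-pred k (Finₚ.toℕ<n q) (p≢j ∘ Finₚ.toℕ-injective)

∸-gain : ∀ {g₀ g₁ m b} → g₀ + b ≤ g₁ → g₁ ≤ m → (m ∸ g₁) + b ≤ m ∸ g₀
∸-gain {g₀} {g₁} {m} {b} g₀+b≤g₁ g₁≤m = m+n≤o⇒m≤o∸n (m ∸ g₁ + b) (begin
  m ∸ g₁ + b + g₀   ≡⟨ +-assoc (m ∸ g₁) b g₀ ⟩
  m ∸ g₁ + (b + g₀) ≤⟨ +-monoʳ-≤ (m ∸ g₁) (≤-trans (≤-reflexive (+-comm b g₀)) g₀+b≤g₁) ⟩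
  m ∸ g₁ + g₁       ≡⟨ m∸n+n≡m g₁≤m ⟩
  m                 ∎)
  where open ≤-Reasoning

double-progress : ∀ {e₀ e₁ b} → e₁ + b ≤ e₀ → 2 * e₁ + (1 + b) ≤ 2 * e₀ + 1
double-progress {e₀} {e₁} {b} e₁+b≤e₀ = begin
  2 * e₁ + (1 + b)     ≡⟨ +-suc (2 * e₁) b ⟩
  suc (2 * e₁ + b)     ≤⟨ s≤s (+-monoʳ-≤ (2 * e₁) (m≤m+n b (b + 0))) ⟩
  suc (2 * e₁ + 2 * b) ≡⟨ cong suc (*-distribˡ-+ 2 e₁ b) ⟨
  suc (2 * (e₁ + b))   ≤⟨ s≤s (*-monoʳ-≤ 2 e₁+b≤e₀) ⟩
  suc (2 * e₀)         ≡⟨ +-comm 1 (2 * e₀) ⟩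
  2 * e₀ + 1           ∎
  where open ≤-Reasoning

≤-suc⇒≤-double : ∀ {e b} → 0 < e → b ≤ suc e → b ≤ 2 * e
≤-suc⇒≤-double {e} 0<e b≤1+e =
  ≤-trans b≤1+e (≤-trans (+-monoˡ-≤ e 0<e) (≤-reflexive (cong (e +_) (sym (+-identityʳ e)))))

-- For one column over a window: g₀, g₁ good body entries at its start and end, b good entries
-- in R at its start; the hypotheses are monotonicity, the pigeonhole bound and the transit lemma.
column-deficit : ∀ {m g₀ g₁ b} (d : Dec (g₀ < m)) → g₀ ≤ g₁ → g₁ ≤ m → b + g₀ ≤ suc m →
               (g₁ < m → g₀ + b ≤ g₁) → 2 * (m ∸ g₁) + (⟦ d ⟧ + b) ≤ 2 * (m ∸ g₀) + 1
column-deficit {m} {g₀} {g₁} {b} (yes g₀<m) g₀≤g₁ g₁≤m b+g₀≤1+m gain with g₁ <? m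
... | yes g₁<m = double-progress (∸-gain (gain g₁<m) g₁≤m)
... | no g₁≮m rewrite m≤n⇒m∸n≡0 (≮⇒≥ g₁≮m) = begin
  1 + b              ≡⟨ +-comm 1 b ⟩
  b + 1              ≤⟨ +-monoˡ-≤ 1 (≤-suc⇒≤-double (m<n⇒0<n∸m g₀<m) b≤1+e₀) ⟩
  2 * (m ∸ g₀) + 1   ∎
  where
  open ≤-Reasoning
  b≤1+e₀ : b ≤ suc (m ∸ g₀)
  b≤1+e₀ = ≤-trans (m+n≤o⇒m≤o∸n b b+g₀≤1+m) (≤-reflexive (+-∸-assoc 1 (<⇒≤ g₀<m)))
column-deficit {m} {g₀} {g₁} {b} (no g₀≮m) g₀≤g₁ g₁≤m b+g₀≤1+m gain
  rewrite m≤n⇒m∸n≡0 (≮⇒≥ g₀≮m) | m≤n⇒m∸n≡0 (≤-trans (≮⇒≥ g₀≮m) g₀≤g₁) =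
  +-cancelʳ-≤ m b 1 (≤-trans (+-monoʳ-≤ b (≮⇒≥ g₀≮m)) b+g₀≤1+m)

∸≤-scaled-indicator : ∀ {m g} (d : Dec (g < m)) → m ∸ g ≤ suc m * ⟦ d ⟧
∸≤-scaled-indicator {m} {g} (yes _)  =
  ≤-trans (m∸n≤m m g) (≤-trans (n≤1+n m) (≤-reflexive (sym (*-identityʳ (suc m)))))
∸≤-scaled-indicator {m} {g} (no g≮m) = ≤-trans (≤-reflexive (m≤n⇒m∸n≡0 (≮⇒≥ g≮m))) z≤n

scaled-below⇒≡0 : ∀ {a x c} → a * x ≤ c → c < a → x ≡ 0
scaled-below⇒≡0 {x = zero}  _     _   = refl
scaled-below⇒≡0 {a} {suc x} ax≤c c<a =
  ⊥-elim (<-irrefl refl (<-≤-trans c<a (≤-trans (m≤m*n a (suc x)) ax≤c)))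

-- Geometric decay

module Decay (c : ℕ) .{{_ : NonZero c}} (d : ℕ → ℕ) (step : ∀ t → c * d (suc t) + d t ≤ c * d t) where

  decreasing : ∀ t → d (suc t) ≤ d t
  decreasing t = *-cancelˡ-≤ c (≤-trans (m≤m+n _ (d t)) (step t))

  telescoping : ∀ r → c * d r + r * d r ≤ c * d 0
  telescoping zero = ≤-reflexive (+-identityʳ _)
  telescoping (suc r) = begin
    c * d (suc r) + (d (suc r) + r * d (suc r)) ≡⟨ +-assoc (c * d (suc r)) _ _ ⟨
    c * d (suc r) + d (suc r) + r * d (suc r)   ≤⟨ +-mono-≤ (+-monoʳ-≤ (c * d (suc r)) (decreasing r))
                                                             (*-monoʳ-≤ r (decreasing r)) ⟩
    c * d (suc r) + d r + r * d r               ≤⟨ +-monoˡ-≤ (r * d r) (step r) ⟩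
    c * d r + r * d r                           ≤⟨ telescoping r ⟩
    c * d 0                                     ∎
    where open ≤-Reasoning

  halves : 2 * d c ≤ d 0
  halves = *-cancelˡ-≤ c (begin
    c * (2 * d c)       ≡⟨ *-distribˡ-+ c (d c) (d c + 0) ⟩
    c * d c + c * (d c + 0)  ≡⟨ cong (λ x → c * d c + c * x) (+-identityʳ (d c)) ⟩
    c * d c + c * d c   ≤⟨ telescoping c ⟩
    c * d 0             ∎)
    where open ≤-Reasoning

geometric-decay : ∀ c .{{_ : NonZero c}} (d : ℕ → ℕ) → (∀ t → c * d (suc t) + d t ≤ c * d t) →
                  ∀ h → 2 ^ h * d (h * c) ≤ d 0
geometric-decay c d step zero = ≤-reflexive (*-identityˡ (d 0))
geometric-decay c d step (suc h) = begin
  2 * 2 ^ h * d (c + h * c)     ≡⟨ *-assoc 2 (2 ^ h) _ ⟩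
  2 * (2 ^ h * d (c + h * c))   ≡⟨ cong (λ t → 2 * (2 ^ h * d t)) (+-comm c (h * c)) ⟩
  2 * (2 ^ h * d (h * c + c))   ≤⟨ *-monoʳ-≤ 2 (geometric-decay c (λ t → d (t + c)) (λ t → step (t + c)) h) ⟩
  2 * d c                       ≤⟨ Decay.halves c d step ⟩
  d 0                           ∎
  where open ≤-Reasoning

-- Rotations only permute entries

iterBody-add : ∀ .{{_ : NonZero n}} s t (A : Mat m n) → iterBody (s + t) A ≡ iterBody t (iterBody s A)
iterBody-add zero    t A = refl
iterBody-add (suc s) t A = iterBody-add s t (outerBody A)

iterBody-suc : ∀ .{{_ : NonZero n}} t (A : Mat m n) → iterBody (suc t) A ≡ outerBody (iterBody t A)
iterBody-suc t A = trans (cong (λ s → iterBody s A) (+-comm 1 t)) (iterBody-add t 1 A)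

Distinct : Mat m n → Set
Distinct A = ∀ i j i′ j′ → A i j ≡ A i′ j′ → i ≡ i′ × j ≡ j′

Bounded : Mat m n → Set
Bounded {m} {n} A = ∀ i j → 1 ≤ A i j × A i j ≤ m * n

record Reindexing (A B : Mat m n) : Set where
  field
    source           : Fin m → Fin n → Fin m × Fin n
    source-injective : ∀ {i j i′ j′} → source i j ≡ source i′ j′ → i ≡ i′ × j ≡ j′
    entry            : ∀ i j → B i j ≡ uncurry A (source i j)

  distinct : Distinct A → Distinct B
  distinct dA i j i′ j′ e =
    source-injective (uncurry (cong₂ _,_) (dA _ _ _ _ (trans (sym (entry i j)) (trans e (entry i′ j′)))))

  bounded : Bounded A → Bounded B
  bounded bA i j rewrite entry i j = uncurry bA (source i j)

open Reindexing

reindexing-refl : {A : Mat m n} → Reindexing A A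
reindexing-refl = record
  { source           = _,_
  ; source-injective = λ e → ,-injectiveˡ e , ,-injectiveʳ e
  ; entry            = λ _ _ → refl
  }

reindexing-trans : {A B C : Mat m n} → Reindexing A B → Reindexing B C → Reindexing A C
reindexing-trans σ τ = record
  { source           = λ i j → uncurry (source σ) (source τ i j)
  ; source-injective = λ e → source-injective τ (uncurry (cong₂ _,_) (source-injective σ e))
  ; entry            = λ i j → trans (entry τ i j) (uncurry (entry σ) (source τ i j))
  }

rotC-row : Fin n → Fin m → Fin n → Fin m
rotC-row j i k with k Finₚ.≟ j
... | yes _ = cpred i
... | no  _ = i

rotC-row-injective : (j : Fin n) {i i′ : Fin m} (k : Fin n) → rotC-row j i k ≡ rotC-row j i′ k → i ≡ i′
rotC-row-injective j k e with k Finₚ.≟ j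
... | yes _ = cpred-injective e
... | no  _ = e

rotC-entry : (j : Fin n) (A : Mat m n) → ∀ i k → rotC j A i k ≡ A (rotC-row j i k) k
rotC-entry j A i k with k Finₚ.≟ j
... | yes _ = refl
... | no  _ = refl

reindexing-rotC : (j : Fin n) (A : Mat m n) → Reindexing A (rotC j A)
reindexing-rotC j A = record
  { source           = λ i k → rotC-row j i k , k
  ; source-injective = λ {_} {k} e →
      rotC-row-injective j k (trans (,-injectiveˡ e) (cong (rotC-row j _) (sym (,-injectiveʳ e)))) , ,-injectiveʳ e
  ; entry            = rotC-entry j A
  }

rotR-source : Fin m → Fin n → Fin m × Fin n
rotR-source zero    k = zero , cpred k
rotR-source (suc i) k = suc i , k

rotR-source-injective : ∀ {i k i′ k′} → rotR-source {m} {n} i k ≡ rotR-source i′ k′ → i ≡ i′ × k ≡ k′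
rotR-source-injective {i = zero}  {i′ = zero}   e = refl , cpred-injective (,-injectiveʳ e)
rotR-source-injective {i = zero}  {i′ = suc _}  e = ⊥-elim (Finₚ.0≢1+n (,-injectiveˡ e))
rotR-source-injective {i = suc _} {i′ = zero}   e = ⊥-elim (Finₚ.0≢1+n (sym (,-injectiveˡ e)))
rotR-source-injective {i = suc _} {i′ = suc _}  e = ,-injectiveˡ e , ,-injectiveʳ e

reindexing-rotR : (A : Mat m n) → Reindexing A (rotR A)
reindexing-rotR A = record
  { source           = rotR-source
  ; source-injective = rotR-source-injective
  ; entry            = λ { zero k → refl ; (suc i) k → refl }
  }

reindexing-innerLoop : ∀ .{{_ : NonZero n}} f j (A : Mat m n) → Reindexing A (innerLoop f j A)
reindexing-innerLoop {m = zero}  f j A = reindexing-refl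
reindexing-innerLoop {m = suc m} zero j A = reindexing-refl
reindexing-innerLoop {n = n} {m = suc m} (suc f) j A with col n (A zero j) ≟ suc (toℕ j) | nearFull? A j
... | yes _ | no _ = reindexing-trans (reindexing-rotC j A) (reindexing-innerLoop f j (rotC j A))
... | yes _ | yes _ = reindexing-refl
... | no _  | _     = reindexing-refl

reindexing-sweep : ∀ .{{_ : NonZero n}} (L : List (Fin n)) (A : Mat m n) →
                   Reindexing A (foldl (λ B j → innerLoop m j B) A L)
reindexing-sweep []      A = reindexing-refl
reindexing-sweep (j ∷ L) A = reindexing-trans (reindexing-innerLoop _ j A) (reindexing-sweep L _)

reindexing-iterBody : ∀ .{{_ : NonZero n}} t (A : Mat m n) → Reindexing A (iterBody t A)
reindexing-iterBody zero    A = reindexing-refl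
reindexing-iterBody (suc t) A =
  reindexing-trans (reindexing-trans (reindexing-sweep (allFin _) A) (reindexing-rotR _)) (reindexing-iterBody t _)

module FillColumns (m′ n′ : ℕ) where

  M N : ℕ
  M = suc m′
  N = suc n′

  Good : Fin N → ℕ → Set
  Good j x = col N x ≡ suc (toℕ j)

  good? : ∀ j x → Dec (Good j x)
  good? j x = col N x ≟ suc (toℕ j)

  good-unique : ∀ {j k} x → Good j x → Good k x → j ≡ k
  good-unique x gj gk = Finₚ.toℕ-injective (suc-injective (trans (sym gj) gk))

  columnCount bodyCount rowCount : Mat M N → Fin N → ℕ
  columnCount A j = ∑[ i < M ] ⟦ good? j (A i j) ⟧
  bodyCount   A j = ∑[ i < m′ ] ⟦ good? j (A (suc i) j) ⟧
  rowCount    A j = ∑[ p < N ] ⟦ good? j (A zero p) ⟧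

  SameColumn : Fin N → Mat M N → Mat M N → Set
  SameColumn j A B = ∀ i → A i j ≡ B i j

  columnCount-cong : ∀ j A B → SameColumn j A B → columnCount A j ≡ columnCount B j
  columnCount-cong j A B A≡B = sum-cong-≗ (λ i → cong (λ x → ⟦ good? j x ⟧) (A≡B i))

  nearFull-cong : ∀ j A B → SameColumn j A B → NearFull A j → NearFull B j
  nearFull-cong j A B A≡B nf i 0<i = trans (cong (col N) (sym (A≡B i))) (nf i 0<i)

  bodyCount≤ : ∀ A j → bodyCount A j ≤ m′
  bodyCount≤ A j = sum-≤-length (λ i → ⟦⟧≤1 (good? j (A (suc i) j)))

  nearFull⇒bodyCount : ∀ A j → NearFull A j → bodyCount A j ≡ m′
  nearFull⇒bodyCount A j nf = trans (sum-cong-≗ (λ i → ⟦yes⟧ (good? j (A (suc i) j)) (nf (suc i) z<s)))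
                                        (trans (sum-const m′ 1) (*-identityʳ m′))

  bodyCount⇒nearFull : ∀ A j → bodyCount A j ≡ m′ → NearFull A j
  bodyCount⇒nearFull A j full (suc i) _ with good? j (A (suc i) j)
  ... | yes good = good
  ... | no bad   = ⊥-elim (<-irrefl full (sum-<-length _ (λ i → ⟦⟧≤1 (good? j (A (suc i) j))) i (⟦no⟧ _ bad)))

  rotC-column : ∀ j (A : Mat M N) i → rotC j A i j ≡ A (cpred i) j
  rotC-column j A i with j Finₚ.≟ j
  ... | yes _  = refl
  ... | no j≢j = ⊥-elim (j≢j refl)

  rotC-other : ∀ {j k} (A : Mat M N) i → k ≢ j → rotC j A i k ≡ A i k
  rotC-other {j} {k} A i k≢j with k Finₚ.≟ j
  ... | yes k≡j = ⊥-elim (k≢j k≡j)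
  ... | no _    = refl

  columnCount-rotC : ∀ j (A : Mat M N) → columnCount (rotC j A) j ≡ columnCount A j
  columnCount-rotC j A = trans (sum-cong-≗ (λ i → cong (λ x → ⟦ good? j x ⟧) (rotC-column j A i)))
                               (sum-cpred (λ i → ⟦ good? j (A i j) ⟧))

  innerLoop-unfold : ∀ f j (A : Mat M N) →
      (Good j (A zero j) × ¬ NearFull A j × innerLoop (suc f) j A ≡ innerLoop f j (rotC j A))
    ⊎ ((¬ Good j (A zero j) ⊎ NearFull A j) × innerLoop (suc f) j A ≡ A)
  innerLoop-unfold f j A with good? j (A zero j) | nearFull? A j
  ... | yes good | no ¬nf = inj₁ (good , ¬nf , refl)
  ... | yes _    | yes nf = inj₂ (inj₂ nf , refl)
  ... | no bad   | _      = inj₂ (inj₁ bad , refl)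

  innerLoop-other : ∀ f {j k} (A : Mat M N) i → k ≢ j → innerLoop f j A i k ≡ A i k
  innerLoop-other zero    A i k≢j = refl
  innerLoop-other (suc f) {j} A i k≢j with innerLoop-unfold f j A
  ... | inj₁ (_ , _ , e) =
    trans (cong (λ B → B i _) e) (trans (innerLoop-other f (rotC j A) i k≢j) (rotC-other A i k≢j))
  ... | inj₂ (_ , e)     = cong (λ B → B i _) e

  innerLoop-columnCount : ∀ f j (A : Mat M N) → columnCount (innerLoop f j A) j ≡ columnCount A j
  innerLoop-columnCount zero    j A = refl
  innerLoop-columnCount (suc f) j A with innerLoop-unfold f j A
  ... | inj₁ (_ , _ , e) = trans (cong (λ B → columnCount B j) e)
                                 (trans (innerLoop-columnCount f j (rotC j A)) (columnCount-rotC j A))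
  ... | inj₂ (_ , e)     = cong (λ B → columnCount B j) e

  innerLoop-bad-top : ∀ f j (A : Mat M N) → ¬ Good j (A zero j) → innerLoop f j A ≡ A
  innerLoop-bad-top zero    j A bad = refl
  innerLoop-bad-top (suc f) j A bad with innerLoop-unfold f j A
  ... | inj₁ (good , _) = ⊥-elim (bad good)
  ... | inj₂ (_ , e)    = e

  innerLoop-column-cong : ∀ f j (A B : Mat M N) →
                          SameColumn j A B → SameColumn j (innerLoop f j A) (innerLoop f j B)
  innerLoop-column-cong zero    j A B A≡B = A≡B
  innerLoop-column-cong (suc f) j A B A≡B i with innerLoop-unfold f j A | innerLoop-unfold f j B
  ... | inj₁ (_ , _ , eA) | inj₁ (_ , _ , eB) =
    trans (cong (λ C → C i j) eA)
          (trans (innerLoop-column-cong f j (rotC j A) (rotC j B) (λ i′ → trans (rotC-column j A i′)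
                                                     (trans (A≡B (cpred i′)) (sym (rotC-column j B i′)))) i)
                 (cong (λ C → C i j) (sym eB)))
  ... | inj₂ (_ , eA) | inj₂ (_ , eB) =
    trans (cong (λ C → C i j) eA) (trans (A≡B i) (cong (λ C → C i j) (sym eB)))
  ... | inj₁ (good , ¬nf , _) | inj₂ (inj₁ bad , _) = ⊥-elim (bad (subst (Good j) (A≡B zero) good))
  ... | inj₁ (good , ¬nf , _) | inj₂ (inj₂ nf , _)  = ⊥-elim (¬nf (nearFull-cong j B A (sym ∘ A≡B) nf))
  ... | inj₂ (inj₁ bad , _) | inj₁ (good , ¬nf , _) = ⊥-elim (bad (subst (Good j) (sym (A≡B zero)) good))
  ... | inj₂ (inj₂ nf , _)  | inj₁ (good , ¬nf , _) = ⊥-elim (¬nf (nearFull-cong j A B A≡B nf))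

  Settled : Fin N → Mat M N → Set
  Settled j A = NearFull A j ⊎ ¬ Good j (A zero j)

  -- A bad entry at row i ≠ 0 reaches the top after M ∸ i rotations of its column.
  BadWithin : ℕ → Fin N → Mat M N → Set
  BadWithin f j A = ∃[ i ] (¬ Good j (A i j) × (toℕ i ≡ 0 ⊎ M ≤ toℕ i + f))

  badWithin-rotC : ∀ f j (A : Mat M N) → Good j (A zero j) → BadWithin (suc f) j A → BadWithin f j (rotC j A)
  badWithin-rotC f j A good (zero , bad , _) = ⊥-elim (bad good)
  badWithin-rotC f j A good (suc i , bad , inj₁ ())
  badWithin-rotC f j A good (suc i , bad , inj₂ M≤i+f) with cpred-preimage (suc i)
  ... | i′ , cpred-i′≡i , i′-position =
    i′ , bad ∘ subst (Good j) (trans (rotC-column j A i′) (cong (λ i → A i j) cpred-i′≡i)) , moved i′-position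
    where
    moved : i′ ≡ zero ⊎ toℕ i′ ≡ suc (toℕ (suc i)) → toℕ i′ ≡ 0 ⊎ M ≤ toℕ i′ + f
    moved (inj₁ refl) = inj₁ refl
    moved (inj₂ e)    = inj₂ (≤-trans M≤i+f (≤-reflexive (trans (+-suc _ f) (cong (_+ f) (sym e)))))

  innerLoop-settles : ∀ f j (A : Mat M N) → NearFull A j ⊎ BadWithin f j A → Settled j (innerLoop f j A)
  innerLoop-settles zero j A (inj₁ nf)                   = inj₁ nf
  innerLoop-settles zero j A (inj₂ (zero , bad , _))     = inj₂ bad
  innerLoop-settles zero j A (inj₂ (suc i , _ , inj₁ ()))
  innerLoop-settles zero j A (inj₂ (suc i , _ , inj₂ M≤i+0)) =
    ⊥-elim (<⇒≱ (Finₚ.toℕ<n (suc i)) (≤-trans M≤i+0 (≤-reflexive (+-identityʳ _))))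
  innerLoop-settles (suc f) j A start with innerLoop-unfold f j A
  ... | inj₁ (good , ¬nf , e) =
    subst (Settled j) (sym e) (innerLoop-settles f j (rotC j A) (inj₂ (badWithin-rotC f j A good bad)))
    where
    bad : BadWithin (suc f) j A
    bad = fromInj₂ (⊥-elim ∘ ¬nf) start
  ... | inj₂ (stop , e) = subst (Settled j) (sym e) (swap stop)

  nearFull-or-badWithin : ∀ j (A : Mat M N) → NearFull A j ⊎ BadWithin M j A
  nearFull-or-badWithin j A with nearFull? A j
  ... | yes nf = inj₁ nf
  ... | no ¬nf with Finₚ.¬∀⟶∃¬ M _ (λ i → (0 <? toℕ i) →-dec good? j (A i j)) ¬nf
  ...   | i , ¬good = inj₂ (i , (λ good → ¬good (λ _ → good)) , inj₂ (m≤n+m M (toℕ i)))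

  sweep : Mat M N → Mat M N
  sweep A = foldl (λ B j → innerLoop M j B) A (allFin N)

  foldl-untouched : ∀ L (A : Mat M N) {k} → All (k ≢_) L →
                    SameColumn k (foldl (λ B j → innerLoop M j B) A L) A
  foldl-untouched []      A []             i = refl
  foldl-untouched (j ∷ L) A (k≢j ∷ k∉L) i = trans (foldl-untouched L _ k∉L i) (innerLoop-other M A i k≢j)

  foldl-own : ∀ L (A : Mat M N) {k} → Unique L → k ∈ L →
              SameColumn k (foldl (λ B j → innerLoop M j B) A L) (innerLoop M k A)
  foldl-own (j ∷ L) A (j∉L ∷ _) (here refl) = foldl-untouched L _ j∉L
  foldl-own (j ∷ L) A {k} (j∉L ∷ uniq) (there k∈L) i =
    trans (foldl-own L _ uniq k∈L i)
          (innerLoop-column-cong M k (innerLoop M j A) A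
                                 (λ i′ → innerLoop-other M A i′ (λ k≡j → All.lookup j∉L k∈L (sym k≡j))) i)

  sweep-column : ∀ (A : Mat M N) k → SameColumn k (sweep A) (innerLoop M k A)
  sweep-column A k = foldl-own (allFin N) A (allFin⁺ N) (∈-allFin k)

  settled-cong : ∀ k A B → SameColumn k A B → Settled k A → Settled k B
  settled-cong k A B A≡B (inj₁ nf)  = inj₁ (nearFull-cong k A B A≡B nf)
  settled-cong k A B A≡B (inj₂ bad) = inj₂ (bad ∘ subst (Good _) (sym (A≡B zero)))

  sweep-columnCount : ∀ A k → columnCount (sweep A) k ≡ columnCount A k
  sweep-columnCount A k =
    trans (columnCount-cong k (sweep A) (innerLoop M k A) (sweep-column A k)) (innerLoop-columnCount M k A)

  sweep-settles : ∀ A k → Settled k (sweep A)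
  sweep-settles A k = settled-cong k (innerLoop M k A) (sweep A) (sym ∘ sweep-column A k)
                                   (innerLoop-settles M k A (nearFull-or-badWithin k A))

  sweep-bad-top : ∀ A k → ¬ Good k (A zero k) → sweep A zero k ≡ A zero k
  sweep-bad-top A k bad = trans (sweep-column A k zero) (cong (λ B → B zero k) (innerLoop-bad-top M k A bad))

  module Round (T : Mat M N) (k : Fin N) where

    T′ : Mat M N
    T′ = sweep (rotR T)

    arriving : ℕ
    arriving = T zero (cpred k)

    conserves : ⟦ good? k (T′ zero k) ⟧ + bodyCount T′ k ≡ ⟦ good? k arriving ⟧ + bodyCount T k
    conserves = sweep-columnCount (rotR T) k

    conserves-below-bad-top : ¬ Good k (T′ zero k) → ⟦ good? k arriving ⟧ + bodyCount T k ≡ bodyCount T′ k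
    conserves-below-bad-top bad =
      trans (sym conserves) (cong (_+ bodyCount T′ k) (⟦no⟧ (good? k (T′ zero k)) bad))

    absorbs : bodyCount T′ k < m′ → ⟦ good? k arriving ⟧ + bodyCount T k ≡ bodyCount T′ k
    absorbs underfull with sweep-settles (rotR T) k
    ... | inj₁ nf  = ⊥-elim (<-irrefl (nearFull⇒bodyCount T′ k nf) underfull)
    ... | inj₂ bad = conserves-below-bad-top bad

    monotone : bodyCount T k ≤ bodyCount T′ k
    monotone with sweep-settles (rotR T) k
    ... | inj₁ nf  = ≤-trans (bodyCount≤ T k) (≤-reflexive (sym (nearFull⇒bodyCount T′ k nf)))
    ... | inj₂ bad = ≤-trans (m≤n+m (bodyCount T k) _) (≤-reflexive (conserves-below-bad-top bad))

    passes : ¬ Good k arriving → T′ zero k ≡ arriving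
    passes = sweep-bad-top (rotR T) k

  good-count : ∀ x → ∑[ j < N ] ⟦ good? j x ⟧ ≡ 1
  good-count x = trans (sum-cong-≗ λ j → ⟦⟧-cong (good? j x) ((x ∸ 1) % N ≟ toℕ j) suc-injective (cong suc))
                       (count-≟toℕ (m%n<n (x ∸ 1) N))

  rowCount-total : ∀ T → ∑[ j < N ] rowCount T j ≡ N
  rowCount-total T = begin
    ∑[ j < N ] ∑[ p < N ] ⟦ good? j (T zero p) ⟧ ≡⟨ ∑-comm (λ j p → ⟦ good? j (T zero p) ⟧) ⟩
    ∑[ p < N ] ∑[ j < N ] ⟦ good? j (T zero p) ⟧ ≡⟨ sum-cong-≗ (good-count ∘ T zero) ⟩
    ∑[ p < N ] 1                                 ≡⟨ trans (sum-const N 1) (*-identityʳ N) ⟩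
    N                                            ∎
    where open ≡-Reasoning

  quotient : ℕ → ℕ
  quotient x = (x ∸ 1) / N

  -- The M values belonging in column j are j + 1 + yN for y < M.
  Fiber : Fin N → Fin M → ℕ → Set
  Fiber j y x = Good j x × quotient x ≡ toℕ y

  fiber? : ∀ j y x → Dec (Fiber j y x)
  fiber? j y x = good? j x ×-dec (quotient x ≟ toℕ y)

  fiber-injective : ∀ {j y x x′} → 1 ≤ x → 1 ≤ x′ → Fiber j y x → Fiber j y x′ → x ≡ x′
  fiber-injective {x = suc x} {suc x′} _ _ (good , q) (good′ , q′) = cong suc (begin
    x                          ≡⟨ m≡m%n+[m/n]*n x N ⟩
    x % N + x / N * N          ≡⟨ cong₂ (λ r s → r + s * N) (trans (suc-injective good) (sym (suc-injective good′)))
                                                             (trans q (sym q′)) ⟩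
    x′ % N + x′ / N * N        ≡⟨ m≡m%n+[m/n]*n x′ N ⟨
    x′                         ∎)
    where open ≡-Reasoning

  good-fibers : ∀ j x → 1 ≤ x → x ≤ M * N → ⟦ good? j x ⟧ ≡ ∑[ y < M ] ⟦ fiber? j y x ⟧
  good-fibers j (suc x) _ x<MN = split (good? j (suc x))
    where
    split : (d : Dec (Good j (suc x))) → ⟦ d ⟧ ≡ ∑[ y < M ] ⟦ d ×-dec (quotient (suc x) ≟ toℕ y) ⟧
    split (yes good) = sym (trans (sum-cong-≗ {M} λ y → ⟦⟧-cong (yes good ×-dec (quotient (suc x) ≟ toℕ y))
                                                            (quotient (suc x) ≟ toℕ y) proj₂ (good ,_))
                                  (count-≟toℕ {k = M} {x = quotient (suc x)} (m<n*o⇒m/o<n {n = M} {o = N} x<MN)))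
    split (no bad)   = sym (count-none {P = λ y → Fiber j y (suc x)} (λ y → no bad ×-dec (quotient (suc x) ≟ toℕ y))
                                       (λ y → bad ∘ proj₁))

  pigeonhole : ∀ T → Distinct T → Bounded T → ∀ k → rowCount T k + bodyCount T k ≤ M
  pigeonhole T distinct bounded k = begin
    rowCount T k + bodyCount T k
      ≡⟨ cong₂ _+_ (sum-cong-≗ λ p → uncurry (good-fibers k (T zero p)) (bounded zero p))
                   (sum-cong-≗ λ i → uncurry (good-fibers k (T (suc i) k)) (bounded (suc i) k)) ⟩
    ∑[ p < N ] ∑[ y < M ] ⟦ fiber? k y (T zero p) ⟧ + ∑[ i < m′ ] ∑[ y < M ] ⟦ fiber? k y (T (suc i) k) ⟧
      ≡⟨ cong₂ _+_ (∑-comm (λ p y → ⟦ fiber? k y (T zero p) ⟧))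
                   (∑-comm (λ i y → ⟦ fiber? k y (T (suc i) k) ⟧)) ⟩
    ∑[ y < M ] ∑[ p < N ] ⟦ fiber? k y (T zero p) ⟧ + ∑[ y < M ] ∑[ i < m′ ] ⟦ fiber? k y (T (suc i) k) ⟧
      ≡⟨ ∑-distrib-+ (λ y → ∑[ p < N ] ⟦ fiber? k y (T zero p) ⟧)
                     (λ y → ∑[ i < m′ ] ⟦ fiber? k y (T (suc i) k) ⟧) ⟨
    ∑[ y < M ] (∑[ p < N ] ⟦ fiber? k y (T zero p) ⟧ + ∑[ i < m′ ] ⟦ fiber? k y (T (suc i) k) ⟧)
      ≤⟨ sum-mono-≤ one-position ⟩
    ∑[ y < M ] 1
      ≡⟨ trans (sum-const M 1) (*-identityʳ M) ⟩
    M ∎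
    where
    open ≤-Reasoning
    same-entry : ∀ {y i j i′ j′} → Fiber k y (T i j) → Fiber k y (T i′ j′) → i ≡ i′ × j ≡ j′
    same-entry {i = i} {j} {i′} {j′} f f′ =
      distinct i j i′ j′ (fiber-injective (proj₁ (bounded i j)) (proj₁ (bounded i′ j′)) f f′)
    one-position : ∀ y →
                   ∑[ p < N ] ⟦ fiber? k y (T zero p) ⟧ + ∑[ i < m′ ] ⟦ fiber? k y (T (suc i) k) ⟧ ≤ 1
    one-position y = count-unique₂ (λ p → fiber? k y (T zero p)) (λ i → fiber? k y (T (suc i) k))
      (λ f f′ → proj₂ (same-entry f f′)) (λ f f′ → Finₚ.suc-injective (proj₁ (same-entry f f′)))
      (λ f f′ → Finₚ.0≢1+n (proj₁ (same-entry f f′)))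

  deficiency : Mat M N → ℕ
  deficiency T = ∑[ j < N ] (m′ ∸ bodyCount T j)

  module Run (S : Mat M N) where

    state : ℕ → Mat M N
    state zero    = sweep S
    state (suc t) = sweep (rotR (state t))

    state-iterBody : ∀ t → state t ≡ sweep (iterBody t S)
    state-iterBody zero    = refl
    state-iterBody (suc t) = trans (cong (sweep ∘ rotR) (state-iterBody t)) (cong sweep (sym (iterBody-suc t S)))

    filled : ℕ → Fin N → ℕ
    filled t j = bodyCount (state t) j

    filled-mono : ∀ s d j → filled s j ≤ filled (s + d) j
    filled-mono s zero    j = ≤-reflexive (cong (λ t → filled t j) (sym (+-identityʳ s)))
    filled-mono s (suc d) j = ≤-trans (filled-mono s d j)
      (≤-trans (Round.monotone (state (s + d)) j) (≤-reflexive (cong (λ t → filled t j) (sym (+-suc s d)))))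

    -- R[p] belongs in column j and reaches R[j] within r rounds. Such an entry cannot leave R on
    -- the way, because the column it sits on is not rotated while its top entry is foreign to it.
    near? : ∀ t j r p → Dec (cyclicDistance p j ≤ r × Good j (state t zero p))
    near? t j r p = (cyclicDistance p j ≤? r) ×-dec good? j (state t zero p)

    approaching : ℕ → Fin N → ℕ → ℕ
    approaching t j r = ∑[ p < N ] ⟦ near? t j r p ⟧

    approach-step : ∀ t j r → filled (suc t) j < m′ →
                    filled t j + approaching t j (suc r) ≤ filled (suc t) j + approaching (suc t) j r
    approach-step t j r underfull = begin
      filled t j + approaching t j (suc r)                ≡⟨ cong (filled t j +_) (sum-cpred now) ⟨
      filled t j + sum (now ∘ cpred)                      ≤⟨ +-monoʳ-≤ (filled t j)
                                                               (sum-split-at (now ∘ cpred) next j arrives moves-on) ⟩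
      filled t j + (⟦ good? j arriving ⟧ + approaching (suc t) j r)
                                                          ≡⟨ x∙yz≈yx∙z (filled t j) ⟦ good? j arriving ⟧ _ ⟩
      ⟦ good? j arriving ⟧ + filled t j + approaching (suc t) j r
                                                          ≡⟨ cong (_+ approaching (suc t) j r)
                                                                  (Round.absorbs (state t) j underfull) ⟩
      filled (suc t) j + approaching (suc t) j r          ∎
      where
      open ≤-Reasoning
      arriving : ℕ
      arriving = state t zero (cpred j)
      now next : Fin N → ℕ
      now  p = ⟦ near? t j (suc r) p ⟧
      next p = ⟦ near? (suc t) j r p ⟧
      arrives : now (cpred j) ≤ ⟦ good? j arriving ⟧
      arrives = ⟦⟧-mono (near? t j (suc r) (cpred j)) (good? j arriving) proj₂
      moves-on : ∀ p → p ≢ j → now (cpred p) ≤ next p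
      moves-on p p≢j = ⟦⟧-mono (near? t j (suc r) (cpred p)) (near? (suc t) j r p) λ (close , good) →
        ≤-pred (subst (_≤ suc r) (cyclicDistance-cpred p j p≢j) close) ,
        subst (Good j) (sym (Round.passes (state t) p (p≢j ∘ sym ∘ good-unique (state t zero (cpred p)) good))) good

    approach : ∀ r t j → filled (t + r) j < m′ → filled t j + approaching t j r ≤ filled (t + r) j
    approach zero t j _ = ≤-reflexive (trans (cong (filled t j +_) nothing-near)
                                      (trans (+-identityʳ (filled t j)) (cong (λ s → filled s j) (sym (+-identityʳ t)))))
      where
      nothing-near : approaching t j 0 ≡ 0
      nothing-near = count-none (near? t j 0) (λ p (close , _) → <⇒≱ (cyclicDistance-positive p j) close)
    approach (suc r) t j underfull = begin
      filled t j + approaching t j (suc r)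
        ≤⟨ approach-step t j r (≤-<-trans (filled-mono (suc t) r j) underfull′) ⟩
      filled (suc t) j + approaching (suc t) j r ≤⟨ approach r (suc t) j underfull′ ⟩
      filled (suc t + r) j                       ≡⟨ cong (λ s → filled s j) (sym (+-suc t r)) ⟩
      filled (t + suc r) j                       ∎
      where
      open ≤-Reasoning
      underfull′ : filled (suc t + r) j < m′
      underfull′ = subst (λ s → filled s j < m′) (+-suc t r) underfull

    transit : ∀ j → filled n′ j < m′ → filled 0 j + rowCount (state 0) j ≤ filled n′ j
    transit j underfull = ≤-trans (+-monoʳ-≤ (filled 0 j) (sum-mono-≤ row≤near)) (approach n′ 0 j underfull)
      where
      top-bad : ¬ Good j (state 0 zero j)
      top-bad with sweep-settles S j
      ... | inj₁ nf  = ⊥-elim (<⇒≱ underfull (≤-trans (≤-reflexive (sym (nearFull⇒bodyCount (state 0) j nf)))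
                                                     (filled-mono 0 n′ j)))
      ... | inj₂ bad = bad
      row≤near : ∀ p → ⟦ good? j (state 0 zero p) ⟧ ≤ ⟦ near? 0 j n′ p ⟧
      row≤near p = ⟦⟧-mono (good? j (state 0 zero p)) (near? 0 j n′ p)
                           (λ good → cyclicDistance-≤ p j (λ { refl → top-bad good }) , good)


    column-progress : ∀ j → rowCount (state 0) j + filled 0 j ≤ M →
                      2 * (m′ ∸ filled n′ j) + (⟦ filled 0 j <? m′ ⟧ + rowCount (state 0) j)
                        ≤ 2 * (m′ ∸ filled 0 j) + 1
    column-progress j pigeon =
      column-deficit (filled 0 j <? m′) (filled-mono 0 n′ j) (bodyCount≤ (state n′) j) pigeon (transit j)

    underfull : ℕ
    underfull = ∑[ j < N ] ⟦ filled 0 j <? m′ ⟧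

    progress : (∀ j → rowCount (state 0) j + filled 0 j ≤ M) →
               2 * deficiency (state n′) + underfull ≤ 2 * deficiency (state 0)
    progress pigeon = +-cancelʳ-≤ N _ _ (begin
      2 * D₁ + U + N                          ≡⟨ +-assoc (2 * D₁) U N ⟩
      2 * D₁ + (U + N)                        ≡⟨ cong₂ (λ x y → x + (U + y)) (*-distribˡ-sum 2 e₁)
                                                       (sym (rowCount-total (state 0))) ⟩
      sum (λ j → 2 * e₁ j) + (U + sum b)      ≡⟨ cong (sum (λ j → 2 * e₁ j) +_) (∑-distrib-+ u b) ⟨
      sum (λ j → 2 * e₁ j) + sum (λ j → u j + b j)
                                              ≡⟨ ∑-distrib-+ (λ j → 2 * e₁ j) (λ j → u j + b j) ⟨
      ∑[ j < N ] (2 * e₁ j + (u j + b j))     ≤⟨ sum-mono-≤ (λ j → column-progress j (pigeon j)) ⟩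
      ∑[ j < N ] (2 * e₀ j + 1)               ≡⟨ ∑-distrib-+ (λ j → 2 * e₀ j) (λ _ → 1) ⟩
      sum (λ j → 2 * e₀ j) + ∑[ j < N ] 1     ≡⟨ cong₂ _+_ (*-distribˡ-sum 2 e₀)
                                                       (sym (trans (sum-const N 1) (*-identityʳ N))) ⟨
      2 * D₀ + N                              ∎)
      where
      open ≤-Reasoning
      e₀ e₁ u b : Fin N → ℕ
      e₀ j = m′ ∸ filled 0 j
      e₁ j = m′ ∸ filled n′ j
      u  j = ⟦ filled 0 j <? m′ ⟧
      b  j = rowCount (state 0) j
      D₀ D₁ U : ℕ
      D₀ = deficiency (state 0)
      D₁ = deficiency (state n′)
      U  = underfull

    deficiency≤underfull : deficiency (state 0) ≤ M * underfull
    deficiency≤underfull = ≤-trans (sum-mono-≤ (λ j → ∸≤-scaled-indicator (filled 0 j <? m′)))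
                                   (≤-reflexive (sym (*-distribˡ-sum M (λ j → ⟦ filled 0 j <? m′ ⟧))))

    window : (∀ j → rowCount (state 0) j + filled 0 j ≤ M) →
             M * 2 * deficiency (state n′) + deficiency (state 0) ≤ M * 2 * deficiency (state 0)
    window pigeon = begin
      M * 2 * D₁ + D₀                 ≡⟨ cong (_+ D₀) (*-assoc M 2 D₁) ⟩
      M * (2 * D₁) + D₀               ≤⟨ +-monoʳ-≤ (M * (2 * D₁)) deficiency≤underfull ⟩
      M * (2 * D₁) + M * underfull    ≡⟨ *-distribˡ-+ M (2 * D₁) underfull ⟨
      M * (2 * D₁ + underfull)        ≤⟨ *-monoʳ-≤ M (progress pigeon) ⟩
      M * (2 * D₀)                    ≡⟨ *-assoc M 2 D₀ ⟨
      M * 2 * D₀                      ∎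
      where
      open ≤-Reasoning
      D₀ D₁ : ℕ
      D₀ = deficiency (state 0)
      D₁ = deficiency (state n′)

  window : ∀ S → Distinct S → Bounded S →
           M * 2 * deficiency (sweep (iterBody n′ S)) + deficiency (sweep S) ≤ M * 2 * deficiency (sweep S)
  window S distinct bounded =
    subst (λ T → M * 2 * deficiency T + deficiency (sweep S) ≤ M * 2 * deficiency (sweep S))
          (Run.state-iterBody S n′)
          (Run.window S (pigeonhole (sweep S) (Reindexing.distinct swept distinct)
                                              (Reindexing.bounded swept bounded)))
    where
    swept : Reindexing S (sweep S)
    swept = reindexing-sweep (allFin N) S

  deficiency≤ : ∀ T → deficiency T ≤ N * m′
  deficiency≤ T = ≤-trans (sum-mono-≤ (λ j → m∸n≤m m′ (bodyCount T j))) (≤-reflexive (sum-const N m′))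

  deficiency≡0⇒allNearFull : ∀ T → deficiency T ≡ 0 → AllNearFull (rotR T)
  deficiency≡0⇒allNearFull T none j (suc i) _ =
    bodyCount⇒nearFull T j (≤-antisym (bodyCount≤ T j) (m∸n≡0⇒m≤n (sum≡0⇒term≡0 (λ j → m′ ∸ bodyCount T j) none j)))
                       (suc i) z<s

  fills-within : ∀ S → Distinct S → Bounded S → ∀ h → N * m′ < 2 ^ h →
                 AllNearFull (iterBody (suc (h * (M * 2) * n′)) S)
  fills-within S distinct bounded h small =
    subst AllNearFull (sym (iterBody-suc (h * (M * 2) * n′) S))
          (deficiency≡0⇒allNearFull _ (scaled-below⇒≡0 (geometric-decay (M * 2) d step h)
                                                         (≤-<-trans (deficiency≤ (sweep S)) small)))
    where
    d : ℕ → ℕ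
    d t = deficiency (sweep (iterBody (t * n′) S))
    step : ∀ t → M * 2 * d (suc t) + d t ≤ M * 2 * d t
    step t = subst (λ T → M * 2 * deficiency (sweep T) + d t ≤ M * 2 * d t)
                   (sym (trans (cong (λ s → iterBody s S) (+-comm n′ (t * n′))) (iterBody-add (t * n′) n′ S)))
                   (window _ (Reindexing.distinct moved distinct) (Reindexing.bounded moved bounded))
      where
      moved : Reindexing S (iterBody (t * n′) S)
      moved = reindexing-iterBody (t * n′) S

log₂-bound : ∀ n → n < 2 ^ suc ⌊log₂ n ⌋
log₂-bound n = ≰⇒> λ 2^≤n →
  1+n≰n (≤-trans (≤-reflexive (sym (⌊log₂[2^n]⌋≡n (suc ⌊log₂ n ⌋)))) (⌊log₂⌋-mono-≤ 2^≤n))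

log₂-positive : ∀ {n} → 2 ≤ n → 0 < ⌊log₂ n ⌋
log₂-positive 2≤n = ⌊log₂⌋-mono-≤ 2≤n

square-below : ∀ {a n} .{{_ : NonZero n}} → a < n → n * a < 2 ^ (suc ⌊log₂ n ⌋ + suc ⌊log₂ n ⌋)
square-below {a} {n} a<n = begin-strict
  n * a                                 <⟨ *-monoʳ-< n a<n ⟩
  n * n                                 ≤⟨ *-mono-≤ (<⇒≤ (log₂-bound n)) (<⇒≤ (log₂-bound n)) ⟩
  2 ^ suc ⌊log₂ n ⌋ * 2 ^ suc ⌊log₂ n ⌋ ≡⟨ ^-distribˡ-+-* 2 (suc ⌊log₂ n ⌋) (suc ⌊log₂ n ⌋) ⟨
  2 ^ (suc ⌊log₂ n ⌋ + suc ⌊log₂ n ⌋)   ∎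
  where open ≤-Reasoning

rounds-bound : ∀ {l m n} → 0 < l → suc ((suc l + suc l) * (suc m * 2) * n) ≤ 9 * (suc m * suc n * l)
rounds-bound {l} {m} {n} 0<l = begin
  1 + (suc l + suc l) * (suc m * 2) * n
    ≤⟨ +-mono-≤ (≤-trans 0<l (m≤n*m l (suc m * suc n)))
                (*-mono-≤ (*-monoˡ-≤ (suc m * 2) (+-mono-≤ 1+l≤2l 1+l≤2l)) (n≤1+n n)) ⟩
  suc m * suc n * l + (l + l + (l + l)) * (suc m * 2) * suc n
    ≡⟨ collect (suc m) (suc n) l ⟩
  9 * (suc m * suc n * l) ∎
  where
  open ≤-Reasoning
  1+l≤2l : suc l ≤ l + l
  1+l≤2l = +-monoˡ-≤ l 0<l
  collect : ∀ a b c → a * b * c + (c + c + (c + c)) * (a * 2) * b ≡ 9 * (a * b * c)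
  collect = solve-∀

lemma4 : Σ[ c ∈ ℕ ] (0 < c × (∀ (m n : ℕ) → .{{_ : NonZero n}} → 2 ≤ m → m ≤ n →
           (A : Mat m n) → IsPermMatrix A →
           RotationsAtMost A (c * (m * n * ⌊log₂ n ⌋))))
lemma4 = 9 , z<s , bound
  where
  bound : ∀ (m n : ℕ) → .{{_ : NonZero n}} → 2 ≤ m → m ≤ n → (A : Mat m n) → IsPermMatrix A →
          RotationsAtMost A (9 * (m * n * ⌊log₂ n ⌋))
  bound (suc m′) (suc n′) 2≤m m≤n A (bounded , distinct , _) =
    suc (h * (suc m′ * 2) * n′) ,
    rounds-bound {m = m′} {n = n′} (log₂-positive (≤-trans 2≤m m≤n)) ,
    FillColumns.fills-within m′ n′ A distinct bounded h (square-below m≤n)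
    where
    h : ℕ
    h = suc ⌊log₂ suc n′ ⌋ + suc ⌊log₂ suc n′ ⌋
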